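{- Let $p$ be an odd prime. Then (1) for each $i\in\{1,2\}$, $A_i^p$ is generated if and only if $p$ is not a rogue prime; and (2) $A_1^p$ is generated if and only if $A_2^p$ is generated.
   Context: For an odd prime $p$ and $i\in\{1,2\}$, let $A_i^p=(\mathbb{Z}/p\mathbb{Z})^\times\setminus\{(-1)^i \bmod p\}$. For $g\in A_i^p$ define $u_1=g$ and $u_n=2u_{n-1}+(-1)^{i+1}$ in $\mathbb{Z}/p\mathbb{Z}$ for $n>1$; let $g_k^i=\min(\{n\in\mathbb{N}: u_n=0\}\cup\{\infty\})$, and call $\langle g\rangle_i^p=(u_n)_{1\le n<g_k^i}$ the rogue sequence of $g$. A periodic rogue sequence (one that never reaches $0$) is a rogue loop. $p$ is rogue of the $i^{\text{th}}$ kind if some $\langle g\rangle_i^p$, $g\in A_i^p$, is a rogue loop; $p$ is a rogue prime if it is rogue of the $1^{\text{st}}$ and/or $2^{\text{nd}}$ kind. $A_i^p$ is generated if there is $g\in A_i^p$ such that the set of terms of $\langle g\rangle_i^p$ equals $A_i^p$. -}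

module Defs where

open import Data.Nat using (ℕ; zero; suc; _+_; _*_; _∸_; _<_; _≤_)
open import Data.Nat.DivMod using (_%_)
open import Data.Product using (_×_; Σ; ∃)
open import Data.Sum using (_⊎_)
open import Relation.Binary.PropositionalEquality using (_≡_; _≢_)
open import Relation.Nullary using (¬_)

data Kind : Set where
  first second : Kind

-- Reduction mod p (p is prime in all uses, so p ≠ 0; the zero case is a dummy).
_mod_ : ℕ → ℕ → ℕ
x mod zero = x
x mod suc n = x % suc n

-- Residues of ℤ/pℤ are represented by naturals x < p.
-- (-1)^i mod p : for i = 1 it is p - 1, for i = 2 it is 1.
signMod : Kind → ℕ → ℕ
signMod first  p = p ∸ 1
signMod second p = 1

-- (-1)^(i+1) mod p : for i = 1 it is 1, for i = 2 it is p - 1.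
incr : Kind → ℕ → ℕ
incr first  p = 1
incr second p = p ∸ 1

InA : Kind → ℕ → ℕ → Set
InA i p x = (0 < x) × (x < p) × (x ≢ signMod i p)

-- u i p g n is the term u_{n+1} of the recurrence (0-indexed):
-- u_1 = g, u_n = 2 u_{n-1} + (-1)^{i+1} in ℤ/pℤ.
u : Kind → ℕ → ℕ → ℕ → ℕ
u i p g zero    = g
u i p g (suc n) = (2 * u i p g n + incr i p) mod p

-- x is a term of the rogue sequence ⟨g⟩_i^p, i.e. x = u_{n+1} for some n with
-- u_{m+1} ≠ 0 for all m ≤ n (so n+1 < g_k^i).
IsTerm : Kind → ℕ → ℕ → ℕ → Set
IsTerm i p g x = ∃ λ n → (u i p g n ≡ x) × (∀ m → m ≤ n → u i p g m ≢ 0)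

RogueLoop : Kind → ℕ → ℕ → Set
RogueLoop i p g = ∀ n → u i p g n ≢ 0

RogueOfKind : Kind → ℕ → Set
RogueOfKind i p = ∃ λ g → InA i p g × RogueLoop i p g

RoguePrime : ℕ → Set
RoguePrime p = RogueOfKind first p ⊎ RogueOfKind second p

Generated : Kind → ℕ → Set
Generated i p = ∃ λ g → InA i p g × (∀ x → (IsTerm i p g x → InA i p x) × (InA i p x → IsTerm i p g x))

-- For an odd prime p both recurrences x ↦ 2x + (-1)^(i+1) are permutations of ℤ/pℤ that fix
-- (-1)^i and send 0 to (-1)^(i+1), so the rogue sequence of (-1)^(i+1) runs once around the cycle
-- of 0 and avoids (-1)^i. If every g ∈ A_i^p reaches 0, all of A_i^p lies on that cycle and
-- (-1)^(i+1) generates. Conversely, a generating sequence passes through the preimage of 0, so it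
-- stops, and so does its tail from any g ∈ A_i^p: there is no rogue loop. Finally x ↦ -x conjugates
-- the two recurrences and exchanges A_1^p and A_2^p, so p is rogue of one kind iff of the other.
module Submission where

open import Defs
open import Data.Nat using (ℕ; zero; suc; _+_; _*_; _∸_; _<_; _≤_; z≤n; s≤s; z<s; NonZero; _≟_; _≤?_)
open import Data.Nat.Properties
open import Data.Nat.DivMod using (_%_; _/_; m≡m%n+[m/n]*n; m%n<n; m<n⇒m%n≡m; n%n≡0; m*n%n≡0; [m+n]%n≡m%n; %-distribˡ-+; %-distribˡ-*)
open import Data.Nat.Divisibility using (_∣_; divides; ∣m+n∣m⇒∣n; n∣m*n; >⇒∤)
open import Data.Nat.Primality using (Prime; euclidsLemma; prime⇒irreducible; ¬prime[1])
open import Data.Nat.Tactic.RingSolver using (solve-∀)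
open import Data.Fin using (toℕ; fromℕ<)
open import Data.Fin.Properties using (pigeonhole; toℕ-fromℕ<)
open import Data.Product using (∃₂; ∃-syntax; _×_; _,_; proj₁; proj₂)
open import Data.Sum using (_⊎_; inj₁; inj₂; [_,_]; [_,_]′)
open import Function.Base using (_∘_)
open import Function.Bundles using (_⇔_; mk⇔)
import Function.Properties.Equivalence as ⇔
open import Relation.Binary.PropositionalEquality using (_≡_; _≢_; refl; sym; trans; cong; subst; module ≡-Reasoning)
open import Relation.Nullary using (¬_; yes; no; contradiction)
open import Relation.Unary using (Pred; Decidable)

firstBelow : ∀ {ℓ} {P : Pred ℕ ℓ} → Decidable P → ∀ n →
  (∃[ m ] m < n × P m × (∀ {j} → j < m → ¬ P j)) ⊎ (∀ {m} → m < n → ¬ P m)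
firstBelow P? zero = inj₂ λ ()
firstBelow P? (suc n) with firstBelow P? n
... | inj₁ (m , m<n , pm , below) = inj₁ (m , m<n⇒m<1+n m<n , pm , below)
... | inj₂ none with P? n
...   | yes pn = inj₁ (n , ≤-refl , pn , none)
...   | no ¬pn = inj₂ λ m<1+n → [ none , (λ { refl → ¬pn }) ] (m<1+n⇒m<n∨m≡n m<1+n)

bounded-collision : ∀ {b} (f : ℕ → ℕ) → (∀ n → f n < b) → ∃₂ λ m n → m < n × f m ≡ f n
bounded-collision {b} f f<b with m , n , m<n , Fm≡Fn ← pigeonhole (n<1+n b) (λ t → fromℕ< (f<b (toℕ t)))
  = toℕ m , toℕ n , m<n , (begin
    f (toℕ m)                    ≡⟨ toℕ-fromℕ< (f<b (toℕ m)) ⟨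
    toℕ (fromℕ< (f<b (toℕ m)))   ≡⟨ cong toℕ Fm≡Fn ⟩
    toℕ (fromℕ< (f<b (toℕ n)))   ≡⟨ toℕ-fromℕ< (f<b (toℕ n)) ⟩
    f (toℕ n)                    ∎)
  where open ≡-Reasoning

[m+n]%o≡m%o⇒o∣n : ∀ m n o .{{_ : NonZero o}} → (m + n) % o ≡ m % o → o ∣ n
[m+n]%o≡m%o⇒o∣n m n o eq = ∣m+n∣m⇒∣n (divides ((m + n) / o) (+-cancelˡ-≡ (m % o) _ _ (begin
    m % o + (m / o * o + n)         ≡⟨ +-assoc (m % o) _ n ⟨
    m % o + m / o * o + n           ≡⟨ cong (_+ n) (m≡m%n+[m/n]*n m o) ⟨
    m + n                           ≡⟨ m≡m%n+[m/n]*n (m + n) o ⟩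
    (m + n) % o + (m + n) / o * o   ≡⟨ cong (_+ (m + n) / o * o) eq ⟩
    m % o + (m + n) / o * o         ∎))) (n∣m*n (m / o))
  where open ≡-Reasoning

∣∧<⇒≡0 : ∀ {m n} → m ∣ n → n < m → n ≡ 0
∣∧<⇒≡0 {n = zero} _ _ = refl
∣∧<⇒≡0 {n = suc n} m∣n n<m = contradiction m∣n (>⇒∤ n<m)

doubling-injective-mod : ∀ {p} .{{_ : NonZero p}} → Prime p → 2 < p →
  ∀ c {a b} → a < p → b < p → (2 * a + c) % p ≡ (2 * b + c) % p → a ≡ b
doubling-injective-mod {p} pr 2<p c {a} {b} a<p b<p eq =
  [ (λ a≤b → ≤-case a≤b b<p eq) , (λ b≤a → sym (≤-case b≤a a<p (sym eq))) ]′ (≤-total a b)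
  where
  shift-double : ∀ a d e → 2 * (a + d) + e ≡ 2 * a + e + 2 * d
  shift-double = solve-∀
  ≤-case : ∀ {a b} → a ≤ b → b < p → (2 * a + c) % p ≡ (2 * b + c) % p → a ≡ b
  ≤-case {a} a≤b b<p eq with d , refl ← m≤n⇒∃[o]m+o≡n a≤b
    with euclidsLemma 2 d pr ([m+n]%o≡m%o⇒o∣n (2 * a + c) (2 * d) p
           (trans (cong (_% p) (sym (shift-double a d c))) (sym eq)))
  ... | inj₁ p∣2 = contradiction p∣2 (>⇒∤ 2<p)
  ... | inj₂ p∣d =
    sym (trans (cong (a +_) (∣∧<⇒≡0 p∣d (≤-<-trans (m≤n+m d a) b<p))) (+-identityʳ a))

even-or-odd : ∀ n → ∃[ k ] (n ≡ k + k ⊎ n ≡ suc (k + k))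
even-or-odd zero = 0 , inj₁ refl
even-or-odd (suc n) with even-or-odd n
... | k , inj₁ refl = k , inj₂ refl
... | k , inj₂ refl = suc k , inj₁ (cong suc (sym (+-suc k k)))

oddPrime⇒odd : ∀ {p} → Prime p → p ≢ 2 → ∃[ k ] p ≡ suc (k + k)
oddPrime⇒odd {p} pr p≢2 with even-or-odd p
... | k , inj₂ p≡1+2k = k , p≡1+2k
... | k , inj₁ refl
  with prime⇒irreducible pr (divides k (sym (trans (*-suc k 1) (cong (k +_) (*-identityʳ k)))))
...   | inj₁ ()
...   | inj₂ 2≡p = contradiction (sym 2≡p) p≢2

oddPrime⇒1≤half : ∀ k → Prime (suc (k + k)) → 1 ≤ k
oddPrime⇒1≤half zero    pr = contradiction pr ¬prime[1]
oddPrime⇒1≤half (suc k) _  = s≤s z≤n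

step : Kind → ℕ → ℕ → ℕ
step i p x = (2 * x + incr i p) mod p

u-+ : ∀ i p g m n → u i p g (m + n) ≡ u i p (u i p g n) m
u-+ i p g zero    n = refl
u-+ i p g (suc m) n = cong (step i p) (u-+ i p g m n)

u-suc : ∀ i p g n → u i p g (suc n) ≡ u i p (step i p g) n
u-suc i p g zero    = refl
u-suc i p g (suc n) = cong (step i p) (u-suc i p g n)

rogueLoop-fromTerm : ∀ {i p g h} → IsTerm i p g h → RogueLoop i p h → RogueLoop i p g
rogueLoop-fromTerm {i} {p} {g} {h} (n , ugn≡h , nonzero) loop m with m ≤? n
... | yes m≤n = nonzero m m≤n
... | no  m≰n = λ ugm≡0 → loop (m ∸ n) (begin
    u i p h (m ∸ n)             ≡⟨ cong (λ x → u i p x (m ∸ n)) ugn≡h ⟨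
    u i p (u i p g n) (m ∸ n)   ≡⟨ u-+ i p g (m ∸ n) n ⟨
    u i p g (m ∸ n + n)         ≡⟨ cong (u i p g) (m∸n+n≡m (≰⇒≥ m≰n)) ⟩
    u i p g m                   ≡⟨ ugm≡0 ⟩
    0                           ∎)
  where open ≡-Reasoning

u-recurrent : ∀ {i p x a b} → a < b → u i p x a ≡ u i p x b →
  ∀ n → ∃[ m ] m < b × u i p x n ≡ u i p x m
u-recurrent a<b eq zero = 0 , ≤-<-trans z≤n a<b , refl
u-recurrent {i} {p} {a = a} a<b eq (suc n) with u-recurrent a<b eq n
... | m , m<b , un≡um with m≤n⇒m<n∨m≡n m<b
...   | inj₁ 1+m<b = suc m , 1+m<b , cong (step i p) un≡um
...   | inj₂ refl  = a , a<b , trans (cong (step i p) un≡um) (sym eq)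

dual : Kind → Kind
dual first  = second
dual second = first

module OddPrimeModulus (k : ℕ) (pr : Prime (suc (k + k))) where

  p : ℕ
  p = suc (k + k)

  1≤k : 1 ≤ k
  1≤k = oddPrime⇒1≤half k pr

  2≤k+k : 2 ≤ k + k
  2≤k+k = +-mono-≤ 1≤k 1≤k

  u<p : ∀ i {g} n → g < p → u i p g n < p
  u<p i zero    g<p = g<p
  u<p i {g} (suc n) g<p = m%n<n (2 * u i p g n + incr i p) p

  step-injective : ∀ i {a b} → a < p → b < p → step i p a ≡ step i p b → a ≡ b
  step-injective i = doubling-injective-mod pr (s≤s 2≤k+k) (incr i p)

  u-injective : ∀ i {a b} n → a < p → b < p → u i p a n ≡ u i p b n → a ≡ b
  u-injective i zero    a<p b<p eq = eq
  u-injective i (suc n) a<p b<p eq =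
    u-injective i n a<p b<p (step-injective i (u<p i n a<p) (u<p i n b<p) eq)

  incr∈A : ∀ i → InA i p (incr i p)
  incr∈A first  = s≤s z≤n , s≤s (≤-trans (s≤s z≤n) 2≤k+k) , λ 1≡k+k → <⇒≢ 2≤k+k 1≡k+k
  incr∈A second = ≤-trans (s≤s z≤n) 2≤k+k , n<1+n (k + k) , λ k+k≡1 → <⇒≢ 2≤k+k (sym k+k≡1)

  step-0 : ∀ i → step i p 0 ≡ incr i p
  step-0 i = m<n⇒m%n≡m (proj₁ (proj₂ (incr∈A i)))

  step-sign : ∀ i → step i p (signMod i p) ≡ signMod i p
  step-sign first  = begin
    (2 * (k + k) + 1) % p   ≡⟨ cong (_% p) (double-odd k) ⟩
    (k + k + p) % p         ≡⟨ [m+n]%n≡m%n (k + k) p ⟩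
    (k + k) % p             ≡⟨ m<n⇒m%n≡m (n<1+n (k + k)) ⟩
    k + k                   ∎
    where
    open ≡-Reasoning
    double-odd : ∀ k → 2 * (k + k) + 1 ≡ k + k + suc (k + k)
    double-odd = solve-∀
  step-sign second = trans ([m+n]%n≡m%n 1 p) (step-0 first)

  zero-preimage : ∀ i → ∃[ z ] InA i p z × step i p z ≡ 0
  zero-preimage first  = k , (1≤k , s≤s (m≤m+n k k) , <⇒≢ (m<m+n k 1≤k)) ,
    trans (cong (_% p) (double-half k)) (n%n≡0 p)
    where
    double-half : ∀ k → 2 * k + 1 ≡ suc (k + k)
    double-half = solve-∀
  zero-preimage second =
    suc k , (s≤s z≤n , s≤s (+-monoˡ-≤ k 1≤k) , λ 1+k≡1 → <⇒≢ 1≤k (sym (suc-injective 1+k≡1))) ,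
    trans (cong (_% p) (double-half k)) (m*n%n≡0 2 p)
    where
    double-half : ∀ k → 2 * suc k + (k + k) ≡ 2 * suc (k + k)
    double-half = solve-∀

  sign<p : ∀ i → signMod i p < p
  sign<p first  = n<1+n (k + k)
  sign<p second = proj₁ (proj₂ (incr∈A first))

  incr-orbit-avoids-sign : ∀ i n → u i p (incr i p) n ≢ signMod i p
  incr-orbit-avoids-sign i zero    = proj₂ (proj₂ (incr∈A i))
  incr-orbit-avoids-sign i (suc n) eq = incr-orbit-avoids-sign i n
    (step-injective i (u<p i n (proj₁ (proj₂ (incr∈A i)))) (sign<p i) (trans eq (sym (step-sign i))))

  -- The orbit repeats before the collision index b, so a search below b decides whether it
  -- ever hits 0; the negative answer would be a rogue loop.
  ¬rogue⇒reachesZero : ∀ {i x} → InA i p x → ¬ RogueOfKind i p →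
    ∃[ j ] u i p x j ≡ 0 × (∀ {m} → m < j → u i p x m ≢ 0)
  ¬rogue⇒reachesZero {i} {x} x∈A ¬rogue
    with a , b , a<b , ua≡ub ← bounded-collision (u i p x) (λ n → u<p i n (proj₁ (proj₂ x∈A)))
    with firstBelow (λ n → u i p x n ≟ 0) b
  ... | inj₁ (j , _ , uj≡0 , below) = j , uj≡0 , below
  ... | inj₂ none = contradiction (x , x∈A , loop) ¬rogue
    where
    loop : RogueLoop i p x
    loop n un≡0 with m , m<b , un≡um ← u-recurrent a<b ua≡ub n = none m<b (trans (sym un≡um) un≡0)

  zeros-align : ∀ i {x y j t} → x < p → y < p → j ≤ t →
    u i p x j ≡ 0 → u i p y t ≡ 0 → x ≡ u i p y (t ∸ j)
  zeros-align i {x} {y} {j} {t} x<p y<p j≤t uxj≡0 uyt≡0 =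
    u-injective i j x<p (u<p i (t ∸ j) y<p) (begin
      u i p x j                   ≡⟨ uxj≡0 ⟩
      0                           ≡⟨ uyt≡0 ⟨
      u i p y t                   ≡⟨ cong (u i p y) (m+[n∸m]≡n j≤t) ⟨
      u i p y (j + (t ∸ j))       ≡⟨ u-+ i p y j (t ∸ j) ⟩
      u i p (u i p y (t ∸ j)) j   ∎)
    where open ≡-Reasoning

  firstZero≤incr-zero : ∀ i {x j t} → x < p → (∀ {m} → m < j → u i p x m ≢ 0) →
    u i p x j ≡ 0 → u i p (incr i p) t ≡ 0 → j ≤ t
  firstZero≤incr-zero i {x} {j} {t} x<p below uxj≡0 uct≡0 with j ≤? t
  ... | yes j≤t = j≤t
  -- If t < j, injectivity matches the last t + 1 steps of x's orbit with 0 → incr → ⋯ → 0,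
  -- so the orbit of x already vanishes at j ∸ suc t.
  ... | no  j≰t = contradiction ux[j-1-t]≡0 (below (∸-monoʳ-< z<s t<j))
    where
    t<j = ≰⇒> j≰t
    ux[j-1-t]≡0 : u i p x (j ∸ suc t) ≡ 0
    ux[j-1-t]≡0 = u-injective i (suc t) (u<p i (j ∸ suc t) x<p) z<s (begin
      u i p (u i p x (j ∸ suc t)) (suc t) ≡⟨ u-+ i p x (suc t) (j ∸ suc t) ⟨
      u i p x (suc t + (j ∸ suc t))       ≡⟨ cong (u i p x) (m+[n∸m]≡n t<j) ⟩
      u i p x j                           ≡⟨ uxj≡0 ⟩
      0                                   ≡⟨ uct≡0 ⟨
      u i p (incr i p) t                  ≡⟨ cong (λ c → u i p c t) (step-0 i) ⟨
      u i p (step i p 0) t                ≡⟨ u-suc i p 0 t ⟨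
      u i p 0 (suc t)                     ∎)
      where open ≡-Reasoning

  incr-term⇒∈A : ∀ i {x} → IsTerm i p (incr i p) x → InA i p x
  incr-term⇒∈A i (n , ucn≡x , nonzero) = subst (InA i p) ucn≡x
    (n≢0⇒n>0 (nonzero n ≤-refl) , u<p i n (proj₁ (proj₂ (incr∈A i))) , incr-orbit-avoids-sign i n)

  ∈A⇒incr-term : ∀ i {x} → ¬ RogueOfKind i p → InA i p x → IsTerm i p (incr i p) x
  ∈A⇒incr-term i {x} ¬rogue x∈A@(0<x , x<p , _)
    with j , uxj≡0 , x-below ← ¬rogue⇒reachesZero x∈A ¬rogue
    with t , uct≡0 , c-below ← ¬rogue⇒reachesZero (incr∈A i) ¬rogue
    = t ∸ j , sym (zeros-align i x<p (proj₁ (proj₂ (incr∈A i))) j≤t uxj≡0 uct≡0) ,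
      λ m m≤t∸j → c-below (≤-<-trans m≤t∸j (∸-monoʳ-< 0<j j≤t))
    where
    j≤t = firstZero≤incr-zero i x<p x-below uxj≡0 uct≡0
    0<j : 0 < j
    0<j = n≢0⇒n>0 λ { refl → <⇒≢ 0<x (sym uxj≡0) }

  ¬rogue⇒generated : ∀ i → ¬ RogueOfKind i p → Generated i p
  ¬rogue⇒generated i ¬rogue = incr i p , incr∈A i , λ x → incr-term⇒∈A i , ∈A⇒incr-term i ¬rogue

  generated⇒¬rogue : ∀ i → Generated i p → ¬ RogueOfKind i p
  generated⇒¬rogue i (g , _ , terms) (h , h∈A , loop)
    with z , z∈A , step-z≡0 ← zero-preimage i
    with t , ugt≡z , _ ← proj₂ (terms z) z∈A
    = rogueLoop-fromTerm (proj₂ (terms h) h∈A) loop (suc t) (trans (cong (step i p) ugt≡z) step-z≡0)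

  -- a ≡ -b (mod p); a record rather than a bare equation, so that a and b can be inferred.
  record Negatives (a b : ℕ) : Set where
    constructor negatives
    field
      sum%p≡0 : (a + b) % p ≡ 0

  negatives-sym : ∀ {a b} → Negatives a b → Negatives b a
  negatives-sym {a} {b} (negatives a+b≡0) = negatives (subst (λ c → c % p ≡ 0) (+-comm a b) a+b≡0)

  negatives-0 : ∀ {a} → a < p → Negatives a 0 → a ≡ 0
  negatives-0 {a} a<p (negatives a+0≡0) = begin
    a             ≡⟨ m<n⇒m%n≡m a<p ⟨
    a % p         ≡⟨ cong (_% p) (+-identityʳ a) ⟨
    (a + 0) % p   ≡⟨ a+0≡0 ⟩
    0             ∎
    where open ≡-Reasoning

  complement-negatives : ∀ {a} → a ≤ p → Negatives a (p ∸ a)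
  complement-negatives a≤p = negatives (trans (cong (_% p) (m+[n∸m]≡n a≤p)) (n%n≡0 p))

  step-negatives : ∀ i {a b} → Negatives a b → Negatives (step i p a) (step (dual i) p b)
  step-negatives first  = step₁-negatives
    where
    open ≡-Reasoning
    regroup : ∀ a b k → 2 * a + 1 + (2 * b + (k + k)) ≡ 2 * (a + b) + suc (k + k)
    regroup = solve-∀
    step₁-negatives : ∀ {a b} → Negatives a b → Negatives (step first p a) (step second p b)
    step₁-negatives {a} {b} (negatives a+b≡0) = negatives (begin
      ((2 * a + 1) % p + (2 * b + (k + k)) % p) % p ≡⟨ %-distribˡ-+ (2 * a + 1) (2 * b + (k + k)) p ⟨
      (2 * a + 1 + (2 * b + (k + k))) % p           ≡⟨ cong (_% p) (regroup a b k) ⟩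
      (2 * (a + b) + p) % p                         ≡⟨ [m+n]%n≡m%n (2 * (a + b)) p ⟩
      (2 * (a + b)) % p                             ≡⟨ %-distribˡ-* 2 (a + b) p ⟩
      ((2 % p) * ((a + b) % p)) % p                 ≡⟨ cong (λ c → ((2 % p) * c) % p) a+b≡0 ⟩
      ((2 % p) * 0) % p                             ≡⟨ cong (_% p) (*-zeroʳ (2 % p)) ⟩
      0                                             ∎)
  step-negatives second = negatives-sym ∘ step-negatives first ∘ negatives-sym

  u-negatives : ∀ i {a b} n → Negatives a b → Negatives (u i p a n) (u (dual i) p b n)
  u-negatives i zero    a≡-b = a≡-b
  u-negatives i (suc n) a≡-b = step-negatives i (u-negatives i n a≡-b)

  complement-sign : ∀ i → p ∸ signMod (dual i) p ≡ signMod i p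
  complement-sign first  = refl
  complement-sign second = m∸[m∸n]≡n {m = p} (s≤s z≤n)

  rogue-dual : ∀ i → RogueOfKind i p → RogueOfKind (dual i) p
  rogue-dual i (g , (0<g , g<p , g≢s) , loop) =
    p ∸ g , (m<n⇒0<n∸m g<p , ∸-monoʳ-< 0<g (<⇒≤ g<p) , p∸g≢s′) , dual-loop
    where
    open ≡-Reasoning
    p∸g≢s′ : p ∸ g ≢ signMod (dual i) p
    p∸g≢s′ p∸g≡s′ = g≢s (begin
      g                      ≡⟨ m∸[m∸n]≡n (<⇒≤ g<p) ⟨
      p ∸ (p ∸ g)            ≡⟨ cong (p ∸_) p∸g≡s′ ⟩
      p ∸ signMod (dual i) p ≡⟨ complement-sign i ⟩
      signMod i p            ∎)
    dual-loop : RogueLoop (dual i) p (p ∸ g)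
    dual-loop n u′≡0 = loop n (negatives-0 (u<p i n g<p)
      (subst (Negatives (u i p g n)) u′≡0 (u-negatives i n (complement-negatives (<⇒≤ g<p)))))

  roguePrime⇒rogueOfKind : ∀ i → RoguePrime p → RogueOfKind i p
  roguePrime⇒rogueOfKind first  (inj₁ rogue) = rogue
  roguePrime⇒rogueOfKind first  (inj₂ rogue) = rogue-dual second rogue
  roguePrime⇒rogueOfKind second (inj₁ rogue) = rogue-dual first rogue
  roguePrime⇒rogueOfKind second (inj₂ rogue) = rogue

  rogueOfKind⇒roguePrime : ∀ i → RogueOfKind i p → RoguePrime p
  rogueOfKind⇒roguePrime first  = inj₁
  rogueOfKind⇒roguePrime second = inj₂

  generated⇔¬roguePrime : ∀ i → Generated i p ⇔ (¬ RoguePrime p)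
  generated⇔¬roguePrime i = mk⇔
    (λ gen → generated⇒¬rogue i gen ∘ roguePrime⇒rogueOfKind i)
    (λ ¬rogue → ¬rogue⇒generated i (¬rogue ∘ rogueOfKind⇒roguePrime i))

mainTheorem4 : (p : ℕ) → Prime p → p ≢ 2 →
    ((i : Kind) → Generated i p ⇔ (¬ RoguePrime p)) × (Generated first p ⇔ Generated second p)
mainTheorem4 p pr p≢2 with k , refl ← oddPrime⇒odd pr p≢2 =
  generated⇔¬roguePrime , ⇔.trans (generated⇔¬roguePrime first) (⇔.sym (generated⇔¬roguePrime second))
  where open OddPrimeModulus k pr
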